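{- Let $m,n,k$ be integers with $m,n\ge k\ge 3$. (i) The maximum number of $1$'s in an $m\times n$ $(0,1)$-matrix which is $12\cdots k$-avoiding is $(k-1)(m+n-(k-1))$. (ii) The set of $1$'s of every $12\cdots k$-avoiding $m\times n$ $(0,1)$-matrix with exactly $(k-1)(m+n-(k-1))$ $1$'s can be partitioned into $k-1$ R-L zigzag paths of lengths $m+n-1, m+n-3, m+n-5,\dots, m+n-(2k-3)$, respectively. (iii) If $A$ is a $12\cdots k$-avoiding $m\times n$ $(0,1)$-matrix containing fewer than $(k-1)(m+n-(k-1))$ $1$'s, then there is a $0$ in $A$ that can be replaced with a $1$ so that the resulting matrix is still $12\cdots k$-avoiding.
   Context: An $m\times n$ $(0,1)$-matrix $A=[a_{ij}]$ is $12\cdots k$-avoiding if there do not exist rows $i_1<\cdots<i_k$ and columns $j_1<\cdots<j_k$ with $a_{i_1j_1}=\cdots=a_{i_kj_k}=1$. An R-L zigzag path is a sequence of positions $(p,q)=(r_1,c_1),(r_2,c_2),\dots,(r_\ell,c_\ell)=(u,v)$ with $u\ge p$, $v\le q$, in which each step goes from a position to the position immediately to its left or immediately below it (so it is a complete R-L zigzag path of the contiguous submatrix with rows $p,\dots,u$ and columns $v,\dots,q$, running from its upper right corner to its lower left corner); its length is its number of positions $\ell=(u-p)+(q-v)+1$. In (ii) every position of each path holds a $1$ of $A$ and each $1$ of $A$ lies on exactly one of the paths. -}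

module Defs where

open import Data.Nat using (ℕ; zero; suc; _+_; _*_; _∸_)
open import Data.Bool using (Bool; true; false; if_then_else_)
open import Data.Fin using (Fin; zero; suc; _<_; toℕ)
import Data.Fin
open import Data.Product using (_×_; _,_; Σ; ∃; ∃-syntax)
open import Data.List using (List; length)
open import Data.List.Relation.Unary.Linked using (Linked)
open import Data.List.Membership.Propositional using (_∈_)
open import Relation.Binary.PropositionalEquality using (_≡_)
open import Relation.Nullary using (¬_; yes; no)
open import Data.Sum using (_⊎_)

Matrix : ℕ → ℕ → Set
Matrix m n = Fin m → Fin n → Bool

sumFin : (n : ℕ) → (Fin n → ℕ) → ℕ
sumFin zero    f = 0
sumFin (suc n) f = f zero + sumFin n (λ i → f (suc i))

ones : {m n : ℕ} → Matrix m n → ℕ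
ones {m} {n} A = sumFin m (λ i → sumFin n (λ j → if A i j then 1 else 0))

StrictlyIncreasing : {k m : ℕ} → (Fin k → Fin m) → Set
StrictlyIncreasing {k} f = (s t : Fin k) → s < t → f s < f t

Avoiding : (k : ℕ) {m n : ℕ} → Matrix m n → Set
Avoiding k {m} {n} A =
  ¬ (Σ (Fin k → Fin m) λ r → Σ (Fin k → Fin n) λ c →
       StrictlyIncreasing r × StrictlyIncreasing c × ((t : Fin k) → A (r t) (c t) ≡ true))

Pos : ℕ → ℕ → Set
Pos m n = Fin m × Fin n

data Step {m n : ℕ} : Pos m n → Pos m n → Set where
  left  : ∀ {i j j'} → toℕ j ≡ suc (toℕ j') → Step (i , j) (i , j')
  below : ∀ {i i' j} → toℕ i' ≡ suc (toℕ i) → Step (i , j) (i' , j)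

-- an R-L zigzag path: a list of positions (r₁,c₁),…,(r_ℓ,c_ℓ), each consecutive
-- pair being a Step; its length is the number of positions
ZigzagPath : {m n : ℕ} → List (Pos m n) → Set
ZigzagPath = Linked Step

setOne : {m n : ℕ} → Matrix m n → Fin m → Fin n → Matrix m n
setOne A i j i' j' with i Data.Fin.≟ i' | j Data.Fin.≟ j'
... | yes _ | yes _ = true
... | _     | _     = A i' j'

-- Extend the matrix by zeros to the quarter plane ℕ × ℕ.  For a position
-- (i , j) let  depth i j  be the length of a longest chain of 1's lying
-- strictly north-west of (i , j) (each strictly north-west of the next), and
-- height i j  the length of a longest chain strictly south-east of it.  In a
-- 12⋯k-avoiding matrix every 1 satisfies  depth + 1 + height < k, so its depth
-- is < k-1; layer t consists of the 1's of depth t.  Two 1's of one layer are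
-- never in strict north-west position, hence sorting a layer by rows and then
-- by decreasing columns makes the anti-diagonal key  (n - j) + i  strictly
-- increasing inside an interval of  m + n - (2t+1)  values.  Summing over the
-- layers gives (i); when the bound is attained every layer fills its interval,
-- so consecutive keys differ by one step left or down: the zigzag paths of (ii).
-- For (iii), a 0 with  depth + 1 + height < k  can be set to 1 without creating
-- a pattern; if there is no such 0, walking along each diagonal shows that every
-- layer meets every key of its interval, forcing the maximum number of 1's.
-- The existence half of (i) follows by applying (iii) to the zero matrix until
-- the bound is reached.
module Submission where

open import Defs
open import Data.Nat using (ℕ; zero; suc; _+_; _*_; _∸_; _≤_; _<_; z≤n; s≤s; _⊔_; _⊓_; _<?_; _≤?_; _≟_; _≡ᵇ_)
open import Data.Nat.Properties
open import Data.Bool using (Bool; true; false; if_then_else_; _∧_; T)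
import Data.Bool as 𝔹
open import Data.Unit using (tt)
open import Data.Fin using (Fin; toℕ; fromℕ<; opposite)
import Data.Fin as F
import Data.Fin.Properties as FP
open import Data.Product using (_×_; _,_; Σ; proj₁; proj₂)
open import Data.Sum using (_⊎_; inj₁; inj₂)
open import Data.Empty using (⊥-elim)
open import Data.List using (List; []; _∷_; length; map; _++_)
open import Data.List.Properties using (length-++; length-map)
open import Data.List.Relation.Unary.All using (All; []; _∷_)
import Data.List.Relation.Unary.All as All
open import Data.List.Relation.Unary.Any using (here; there)
open import Data.List.Relation.Unary.AllPairs using (AllPairs; []; _∷_)
import Data.List.Relation.Unary.AllPairs as AP
import Data.List.Relation.Unary.AllPairs.Properties as APP
open import Data.List.Relation.Unary.Linked using (Linked; []; [-]; _∷_)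
import Data.List.Relation.Unary.Linked as Lk
open import Data.List.Relation.Unary.Linked.Properties using (AllPairs⇒Linked)
open import Data.List.Membership.Propositional using (_∈_)
open import Data.List.Membership.Propositional.Properties using (∈-++⁻; ∈-++⁺ˡ; ∈-++⁺ʳ; ∈-map⁻; ∈-map⁺)
open import Function using (_∘_)
open import Relation.Nullary using (¬_; Dec; yes; no)
open import Relation.Nullary.Decidable using (_×-dec_)
open import Relation.Binary.Definitions using (tri<; tri≈; tri>)
open import Relation.Binary.PropositionalEquality
open import Data.Nat.Solver using (module +-*-Solver)
open +-*-Solver using (solve; _:+_; _:*_; _:=_; con)

bit : Bool → ℕ
bit b = if b then 1 else 0

bit≤1 : ∀ b → bit b ≤ 1
bit≤1 true  = ≤-refl
bit≤1 false = z≤n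

sum-cong : ∀ n {f g : Fin n → ℕ} → (∀ i → f i ≡ g i) → sumFin n f ≡ sumFin n g
sum-cong zero    e = refl
sum-cong (suc n) e = cong₂ _+_ (e F.zero) (sum-cong n (e ∘ F.suc))

sum-mono : ∀ n {f g : Fin n → ℕ} → (∀ i → f i ≤ g i) → sumFin n f ≤ sumFin n g
sum-mono zero    e = z≤n
sum-mono (suc n) e = +-mono-≤ (e F.zero) (sum-mono n (e ∘ F.suc))

sum-zero : ∀ n {f : Fin n → ℕ} → (∀ i → f i ≡ 0) → sumFin n f ≡ 0
sum-zero zero    e = refl
sum-zero (suc n) e = cong₂ _+_ (e F.zero) (sum-zero n (e ∘ F.suc))

sum-+ : ∀ n (f g : Fin n → ℕ) → sumFin n (λ i → f i + g i) ≡ sumFin n f + sumFin n g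
sum-+ zero    f g = refl
sum-+ (suc n) f g = begin
  f F.zero + g F.zero + sumFin n (λ i → f (F.suc i) + g (F.suc i))
    ≡⟨ cong (f F.zero + g F.zero +_) (sum-+ n (f ∘ F.suc) (g ∘ F.suc)) ⟩
  f F.zero + g F.zero + (sumFin n (f ∘ F.suc) + sumFin n (g ∘ F.suc))
    ≡⟨ solve 4 (λ a b c d → (a :+ b) :+ (c :+ d) := (a :+ c) :+ (b :+ d)) refl
         (f F.zero) (g F.zero) (sumFin n (f ∘ F.suc)) (sumFin n (g ∘ F.suc)) ⟩
  f F.zero + sumFin n (f ∘ F.suc) + (g F.zero + sumFin n (g ∘ F.suc)) ∎
  where open ≡-Reasoning

sum-swap : ∀ a b (f : Fin a → Fin b → ℕ) →
  sumFin a (λ x → sumFin b (f x)) ≡ sumFin b (λ y → sumFin a (λ x → f x y))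
sum-swap zero    b f = sym (sum-zero b (λ _ → refl))
sum-swap (suc a) b f =
  trans (cong (sumFin b (f F.zero) +_) (sum-swap a b (f ∘ F.suc)))
        (sym (sum-+ b (f F.zero) (λ y → sumFin a (λ x → f (F.suc x) y))))

sum-≡⇒pointwise : ∀ n {f g : Fin n → ℕ} → (∀ i → f i ≤ g i) →
                  sumFin n f ≡ sumFin n g → ∀ i → f i ≡ g i
sum-≡⇒pointwise (suc n) {f} {g} le e i = at i
  where
  head≡ : f F.zero ≡ g F.zero
  head≡ = ≤-antisym (le F.zero)
    (+-cancelʳ-≤ (sumFin n (f ∘ F.suc)) (g F.zero) (f F.zero)
      (≤-trans (+-monoʳ-≤ (g F.zero) (sum-mono n (le ∘ F.suc))) (≤-reflexive (sym e))))
  tail≡ : sumFin n (f ∘ F.suc) ≡ sumFin n (g ∘ F.suc)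
  tail≡ = +-cancelˡ-≡ (f F.zero) _ _ (trans e (cong (_+ sumFin n (g ∘ F.suc)) (sym head≡)))
  at : ∀ i → f i ≡ g i
  at F.zero    = head≡
  at (F.suc i) = sum-≡⇒pointwise n (le ∘ F.suc) tail≡ i

sum-indicator : ∀ K x → x < K → sumFin K (λ t → bit (x ≡ᵇ toℕ t)) ≡ 1
sum-indicator (suc K) zero    _        = cong suc (sum-zero K (λ _ → refl))
sum-indicator (suc K) (suc x) (s≤s lt) = sum-indicator K x lt

sum-increment : ∀ n (f g : Fin n → ℕ) (j : Fin n) → (∀ x → x ≢ j → g x ≡ f x) →
                g j ≡ suc (f j) → sumFin n g ≡ suc (sumFin n f)
sum-increment (suc n) f g F.zero others at-j =
  cong₂ _+_ at-j (sum-cong n (λ x → others (F.suc x) (λ ())))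
sum-increment (suc n) f g (F.suc j) others at-j =
  trans (cong₂ _+_ (others F.zero (λ ()))
                   (sum-increment n (f ∘ F.suc) (g ∘ F.suc) j
                      (λ x x≢j → others (F.suc x) (x≢j ∘ FP.suc-injective)) at-j))
        (+-suc (f F.zero) _)

sum-staircase : ∀ K M → K + K ≤ M → sumFin K (λ t → M ∸ (2 * toℕ t + 1)) ≡ K * (M ∸ K)
sum-staircase zero          M             _  = refl
sum-staircase (suc K)       zero          ()
sum-staircase (suc K)       (suc zero)    (s≤s le) with subst (_≤ 0) (+-suc K K) le
... | ()
sum-staircase (suc K)       (suc (suc M)) le = begin
    suc M + sumFin K (λ t → suc (suc M) ∸ (2 * toℕ (F.suc t) + 1))
  ≡⟨ cong (suc M +_) (sum-cong K (λ t → cong (suc (suc M) ∸_) (cong (_+ 1) (*-suc 2 (toℕ t))))) ⟩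
    suc M + sumFin K (λ t → M ∸ (2 * toℕ t + 1))
  ≡⟨ cong (suc M +_) (sum-staircase K M 2K≤M) ⟩
    suc M + K * (M ∸ K)
  ≡⟨ cong (λ x → suc x + K * (M ∸ K)) (sym (m∸n+n≡m K≤M)) ⟩
    suc (M ∸ K + K) + K * (M ∸ K)
  ≡⟨ cong suc (+-assoc (M ∸ K) K _) ⟩
    suc (M ∸ K) + (K + K * (M ∸ K))
  ≡⟨ cong (suc (M ∸ K) +_) (sym (*-suc K (M ∸ K))) ⟩
    suc (M ∸ K) + K * suc (M ∸ K)
  ≡⟨ cong (λ x → x + K * x) (sym (+-∸-assoc 1 K≤M)) ⟩
    (suc M ∸ K) + K * (suc M ∸ K)
  ∎
  where
  open ≡-Reasoning
  2K≤M : K + K ≤ M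
  2K≤M = ≤-pred (≤-pred (subst (_≤ suc (suc M)) (cong suc (+-suc K K)) le))
  K≤M : K ≤ M
  K≤M = ≤-trans (m≤m+n K K) 2K≤M

module Keyed {X : Set} (key : X → ℕ) where

  KeyLess : X → X → Set
  KeyLess x y = key x < key y

  InRange : ℕ → ℕ → X → Set
  InRange lo hi x = lo ≤ key x × key x ≤ hi

  NextKey : X → X → Set
  NextKey x y = key y ≡ suc (key x)

  private
    raiseLow : ∀ {lo hi} x {xs} → All (KeyLess x) xs → All (InRange lo hi) xs →
               All (InRange (suc (key x)) hi) xs
    raiseLow x ltx inR = All.zipWith (λ { (lt , (_ , h)) → lt , h }) (ltx , inR)

  length-≤ : ∀ {lo hi} xs → AllPairs KeyLess xs → All (InRange lo hi) xs →
             length xs ≤ suc hi ∸ lo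
  length-≤ [] _ _ = z≤n
  length-≤ {lo} {hi} (x ∷ xs) (ltx ∷ sorted) ((l , h) ∷ inR) =
    ≤-trans (s≤s (length-≤ xs sorted (raiseLow x ltx inR)))
            (≤-trans (s≤s (∸-monoʳ-≤ hi l)) (≤-reflexive (sym (+-∸-assoc 1 (≤-trans l h)))))

  tight⇒consecutive : ∀ {lo hi} xs → AllPairs KeyLess xs → All (InRange lo hi) xs →
    length xs ≡ suc hi ∸ lo → Linked NextKey xs × (∀ {y ys} → xs ≡ y ∷ ys → key y ≡ lo)
  tight⇒consecutive [] _ _ _ = [] , λ ()
  tight⇒consecutive {lo} {hi} (x ∷ xs) (ltx ∷ sorted) ((l , h) ∷ inR) len = linked , first
    where
    lo≤hi : lo ≤ hi
    lo≤hi = ≤-trans l h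
    len' : length xs ≡ hi ∸ lo
    len' = suc-injective (trans len (+-∸-assoc 1 lo≤hi))
    keyx : key x ≡ lo
    keyx = sym (∸-cancelˡ-≡ lo≤hi h
             (≤-antisym (subst (_≤ hi ∸ key x) len' (length-≤ xs sorted (raiseLow x ltx inR)))
                        (∸-monoʳ-≤ hi l)))
    rest : Linked NextKey xs × (∀ {y ys} → xs ≡ y ∷ ys → key y ≡ suc (key x))
    rest = tight⇒consecutive xs sorted (raiseLow x ltx inR) (trans len' (cong (hi ∸_) (sym keyx)))
    linkHead : ∀ ys → Linked NextKey ys → (∀ {y zs} → ys ≡ y ∷ zs → key y ≡ suc (key x)) →
               Linked NextKey (x ∷ ys)
    linkHead []       _ _  = [-]
    linkHead (y ∷ ys) l hd = hd refl ∷ l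
    linked : Linked NextKey (x ∷ xs)
    linked = linkHead xs (proj₁ rest) (proj₂ rest)
    first : ∀ {y ys} → x ∷ xs ≡ y ∷ ys → key y ≡ lo
    first refl = keyx

  covering⇒length-≥ : ∀ lo hi xs → AllPairs KeyLess xs →
    (∀ v → lo ≤ v → v ≤ hi → Σ X λ x → x ∈ xs × key x ≡ v) → suc hi ∸ lo ≤ length xs
  covering⇒length-≥ lo hi xs sorted cover with lo ≤? hi
  ... | no lo≰hi = ≤-trans (≤-reflexive (m≤n⇒m∸n≡0 (≰⇒> lo≰hi))) z≤n
  covering⇒length-≥ lo hi [] sorted cover | yes lo≤hi with cover lo ≤-refl lo≤hi
  ... | _ , () , _
  covering⇒length-≥ lo hi (x ∷ xs) (ltx ∷ sorted) cover | yes lo≤hi with key x ≤? lo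
  ... | no keyx≰lo with cover lo ≤-refl lo≤hi
  ...   | _ , here refl , e = ⊥-elim (keyx≰lo (≤-reflexive e))
  ...   | y , there y∈ , e = ⊥-elim (keyx≰lo (<⇒≤ (subst (key x <_) e (All.lookup ltx y∈))))
  covering⇒length-≥ lo hi (x ∷ xs) (ltx ∷ sorted) cover | yes lo≤hi | yes keyx≤lo with key x ≟ lo
  ... | yes keyx≡lo =
    ≤-trans (≤-reflexive (+-∸-assoc 1 lo≤hi)) (s≤s (covering⇒length-≥ (suc lo) hi xs sorted cover'))
    where
    cover' : ∀ v → suc lo ≤ v → v ≤ hi → Σ X λ x → x ∈ xs × key x ≡ v
    cover' v lv vh with cover v (≤-trans (n≤1+n lo) lv) vh
    ... | _ , here refl , e = ⊥-elim (<-irrefl (trans (sym keyx≡lo) e) lv)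
    ... | y , there y∈ , e = y , y∈ , e
  ... | no keyx≢lo = ≤-trans (covering⇒length-≥ lo hi xs sorted cover') (n≤1+n _)
    where
    cover' : ∀ v → lo ≤ v → v ≤ hi → Σ X λ x → x ∈ xs × key x ≡ v
    cover' v lv vh with cover v lv vh
    ... | _ , here refl , e = ⊥-elim (keyx≢lo (≤-antisym keyx≤lo (subst (lo ≤_) (sym e) lv)))
    ... | y , there y∈ , e = y , y∈ , e

AllPairs-onMembers : ∀ {X : Set} {R S : X → X → Set} {xs : List X} → AllPairs R xs →
  (∀ {x y} → x ∈ xs → y ∈ xs → R x y → S x y) → AllPairs S xs
AllPairs-onMembers []         f = []
AllPairs-onMembers (rx ∷ rxs) f =
  All.tabulate (λ y∈ → f (here refl) (there y∈) (All.lookup rx y∈))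
  ∷ AllPairs-onMembers rxs (λ x∈ y∈ → f (there x∈) (there y∈))

search : (P : ℕ → Set) → (∀ s → Dec (P s)) → ∀ L →
         (Σ ℕ λ s → s < L × P s) ⊎ (∀ s → s < L → ¬ P s)
search P P? zero = inj₂ (λ s ())
search P P? (suc L) with search P P? L
... | inj₁ (s , s<L , ps) = inj₁ (s , <-trans s<L (n<1+n L) , ps)
... | inj₂ none with P? L
...   | yes pL  = inj₁ (L , n<1+n L , pL)
...   | no ¬pL = inj₂ nowhere
  where
  nowhere : ∀ s → s < suc L → ¬ P s
  nowhere s s<1+L with m≤n⇒m<n∨m≡n (≤-pred s<1+L)
  ... | inj₁ s<L  = none s s<L
  ... | inj₂ refl = ¬pL

search-dec : (P : ℕ → Set) → (∀ s → Dec (P s)) → ∀ L → Dec (Σ ℕ λ s → s < L × P s)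
search-dec P P? L with search P P? L
... | inj₁ found = yes found
... | inj₂ none  = no λ { (s , s<L , ps) → none s s<L ps }

firstSwitch : (P : ℕ → Set) → (∀ s → Dec (P s)) → ∀ a b → a ≤ b → ¬ P a → P b →
              Σ ℕ λ s → a ≤ s × s < b × ¬ P s × P (suc s)
firstSwitch P P? a zero z≤n ¬pa pb = ⊥-elim (¬pa pb)
firstSwitch P P? a (suc b) a≤b ¬pa pb with m≤n⇒m<n∨m≡n a≤b
... | inj₂ refl = ⊥-elim (¬pa pb)
... | inj₁ (s≤s a≤b') with P? b
...   | no ¬pb' = b , a≤b' , n<1+n b , ¬pb' , pb
...   | yes pb' with firstSwitch P P? a b a≤b' ¬pa pb'
...     | s , a≤s , s<b , ¬ps , ps = s , a≤s , <-trans s<b (n<1+n b) , ¬ps , ps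

private
  single : ∀ {n} → Bool → List (Fin (suc n))
  single b = if b then F.zero ∷ [] else []

  length-single : ∀ {n} b → length (single {n} b) ≡ bit b
  length-single true  = refl
  length-single false = refl

  ∈-single : ∀ {n} b {j : Fin (suc n)} → j ∈ single b → j ≡ F.zero × b ≡ true
  ∈-single true (here e) = e , refl

trueCols : ∀ n → (Fin n → Bool) → List (Fin n)
trueCols zero    g = []
trueCols (suc n) g = map F.suc (trueCols n (g ∘ F.suc)) ++ single (g F.zero)

length-trueCols : ∀ n g → length (trueCols n g) ≡ sumFin n (bit ∘ g)
length-trueCols zero    g = refl
length-trueCols (suc n) g = begin
  length (map F.suc (trueCols n (g ∘ F.suc)) ++ single (g F.zero))
    ≡⟨ length-++ (map F.suc (trueCols n (g ∘ F.suc))) ⟩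
  length (map F.suc (trueCols n (g ∘ F.suc))) + length (single {n} (g F.zero))
    ≡⟨ cong₂ _+_ (trans (length-map F.suc (trueCols n (g ∘ F.suc))) (length-trueCols n (g ∘ F.suc)))
                 (length-single {n} (g F.zero)) ⟩
  sumFin n (bit ∘ g ∘ F.suc) + bit (g F.zero)
    ≡⟨ +-comm (sumFin n (bit ∘ g ∘ F.suc)) (bit (g F.zero)) ⟩
  sumFin (suc n) (bit ∘ g) ∎
  where open ≡-Reasoning

∈-trueCols⁻ : ∀ n g {j} → j ∈ trueCols n g → g j ≡ true
∈-trueCols⁻ (suc n) g j∈ with ∈-++⁻ (map F.suc (trueCols n (g ∘ F.suc))) j∈
... | inj₁ j∈map with ∈-map⁻ F.suc j∈map
...   | _ , j'∈ , refl = ∈-trueCols⁻ n (g ∘ F.suc) j'∈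
∈-trueCols⁻ (suc n) g j∈ | inj₂ j∈single with ∈-single (g F.zero) j∈single
... | refl , gj = gj

∈-trueCols⁺ : ∀ n g {j} → g j ≡ true → j ∈ trueCols n g
∈-trueCols⁺ (suc n) g {F.zero} gj =
  ∈-++⁺ʳ (map F.suc (trueCols n (g ∘ F.suc))) (zero∈ (g F.zero) gj)
  where
  zero∈ : ∀ b → b ≡ true → F.zero {n} ∈ single b
  zero∈ true _ = here refl
∈-trueCols⁺ (suc n) g {F.suc j} gj = ∈-++⁺ˡ (∈-map⁺ F.suc (∈-trueCols⁺ n (g ∘ F.suc) gj))

ColBefore : ∀ {n} → Fin n → Fin n → Set
ColBefore j j' = toℕ j' < toℕ j

trueCols-sorted : ∀ n g → AllPairs ColBefore (trueCols n g)
trueCols-sorted zero    g = []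
trueCols-sorted (suc n) g =
  APP.++⁺ (APP.map⁺ (AP.map s≤s (trueCols-sorted n (g ∘ F.suc)))) (sorted-single (g F.zero))
          (All.tabulate (λ x∈ → All.tabulate (λ y∈ → zeroLast x∈ y∈)))
  where
  sorted-single : ∀ b → AllPairs ColBefore (single {n} b)
  sorted-single true  = [] ∷ []
  sorted-single false = []
  zeroLast : ∀ {x y} → x ∈ map F.suc (trueCols n (g ∘ F.suc)) → y ∈ single {n} (g F.zero) →
             ColBefore x y
  zeroLast x∈ y∈ with ∈-map⁻ F.suc x∈ | ∈-single (g F.zero) y∈
  ... | _ , _ , refl | refl , _ = s≤s z≤n

private
  inRow0 : ∀ {m n} → Fin n → Fin (suc m) × Fin n
  inRow0 j = (F.zero , j)

  nextRow : ∀ {m n} → Fin m × Fin n → Fin (suc m) × Fin n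
  nextRow (i , j) = (F.suc i , j)

trueCells : ∀ m n → (Fin m → Fin n → Bool) → List (Fin m × Fin n)
trueCells zero    n sel = []
trueCells (suc m) n sel =
  map (inRow0 {m}) (trueCols n (sel F.zero)) ++ map (nextRow {m} {n}) (trueCells m n (sel ∘ F.suc))

length-trueCells : ∀ m n sel → length (trueCells m n sel) ≡ sumFin m (λ i → sumFin n (bit ∘ sel i))
length-trueCells zero    n sel = refl
length-trueCells (suc m) n sel =
  trans (length-++ (map (inRow0 {m}) (trueCols n (sel F.zero))))
    (cong₂ _+_ (trans (length-map (inRow0 {m}) (trueCols n (sel F.zero))) (length-trueCols n (sel F.zero)))
               (trans (length-map (nextRow {m} {n}) (trueCells m n (sel ∘ F.suc)))
                      (length-trueCells m n (sel ∘ F.suc))))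

∈-trueCells⁻ : ∀ m n sel {i j} → (i , j) ∈ trueCells m n sel → sel i j ≡ true
∈-trueCells⁻ (suc m) n sel x∈ with ∈-++⁻ (map (inRow0 {m}) (trueCols n (sel F.zero))) x∈
... | inj₁ x∈row0 with ∈-map⁻ (inRow0 {m}) x∈row0
...   | _ , j∈ , refl = ∈-trueCols⁻ n (sel F.zero) j∈
∈-trueCells⁻ (suc m) n sel x∈ | inj₂ x∈rest with ∈-map⁻ (nextRow {m} {n}) x∈rest
... | _ , y∈ , refl = ∈-trueCells⁻ m n (sel ∘ F.suc) y∈

∈-trueCells⁺ : ∀ m n sel {i j} → sel i j ≡ true → (i , j) ∈ trueCells m n sel
∈-trueCells⁺ (suc m) n sel {F.zero} s =
  ∈-++⁺ˡ (∈-map⁺ (inRow0 {m}) (∈-trueCols⁺ n (sel F.zero) s))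
∈-trueCells⁺ (suc m) n sel {F.suc i} s =
  ∈-++⁺ʳ (map (inRow0 {m}) (trueCols n (sel F.zero)))
         (∈-map⁺ (nextRow {m} {n}) (∈-trueCells⁺ m n (sel ∘ F.suc) s))

CellBefore : ∀ {m n} → Fin m × Fin n → Fin m × Fin n → Set
CellBefore (i , j) (i' , j') = (toℕ i < toℕ i') ⊎ (i ≡ i' × toℕ j' < toℕ j)

trueCells-sorted : ∀ m n sel → AllPairs CellBefore (trueCells m n sel)
trueCells-sorted zero    n sel = []
trueCells-sorted (suc m) n sel =
  APP.++⁺ (APP.map⁺ (AP.map (λ lt → inj₂ (refl , lt)) (trueCols-sorted n (sel F.zero))))
          (APP.map⁺ (AP.map shift (trueCells-sorted m n (sel ∘ F.suc))))
          (All.tabulate (λ x∈ → All.tabulate (λ y∈ → row0First x∈ y∈)))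
  where
  shift : ∀ {x y : Fin m × Fin n} → CellBefore x y → CellBefore (nextRow x) (nextRow y)
  shift (inj₁ lt)          = inj₁ (s≤s lt)
  shift (inj₂ (refl , lt)) = inj₂ (refl , lt)
  row0First : ∀ {x y} → x ∈ map (inRow0 {m}) (trueCols n (sel F.zero)) →
              y ∈ map (nextRow {m} {n}) (trueCells m n (sel ∘ F.suc)) → CellBefore x y
  row0First x∈ y∈ with ∈-map⁻ (inRow0 {m}) x∈ | ∈-map⁻ (nextRow {m} {n}) y∈
  ... | _ , _ , refl | _ , _ , refl = inj₁ (s≤s z≤n)

-- Chains of 1's in the quarter plane

-- Positions of ℕ × ℕ with the strict and the weak product order
-- (p ≺ q: p is strictly north-west of q).
Pt : Set
Pt = ℕ × ℕ

_≺_ : Pt → Pt → Set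
(i , j) ≺ (i' , j') = i < i' × j < j'

_≼_ : Pt → Pt → Set
(i , j) ≼ (i' , j') = i ≤ i' × j ≤ j'

≺-≼-trans : ∀ {p q r} → p ≺ q → q ≼ r → p ≺ r
≺-≼-trans (a , b) (c , d) = <-≤-trans a c , <-≤-trans b d

≼-≺-trans : ∀ {p q r} → p ≼ q → q ≺ r → p ≺ r
≼-≺-trans (a , b) (c , d) = ≤-<-trans a c , ≤-<-trans b d

≺⇒≼ : ∀ {p q} → p ≺ q → p ≼ q
≺⇒≼ (a , b) = <⇒≤ a , <⇒≤ b

module Chains (B : ℕ → ℕ → Bool) where

  One : Pt → Set
  One (i , j) = B i j ≡ true

  data ChainBelow : Pt → ℕ → Set where
    dnil  : ∀ {p} → ChainBelow p 0
    dcons : ∀ {p c} q → q ≺ p → One q → ChainBelow q c → ChainBelow p (suc c)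

  data ChainAbove : Pt → ℕ → Set where
    anil  : ∀ {p} → ChainAbove p 0
    acons : ∀ {p c} q → p ≺ q → One q → ChainAbove q c → ChainAbove p (suc c)

  ChainBelow-widen : ∀ {p p' c} → ChainBelow p c → p ≼ p' → ChainBelow p' c
  ChainBelow-widen dnil                 _  = dnil
  ChainBelow-widen (dcons q q≺p oq ch) le = dcons q (≺-≼-trans q≺p le) oq ch

  ChainAbove-widen : ∀ {p p' c} → ChainAbove p c → p' ≼ p → ChainAbove p' c
  ChainAbove-widen anil                 _  = anil
  ChainAbove-widen (acons q p≺q oq ch) le = acons q (≼-≺-trans le p≺q) oq ch

  module Join (top : Pt) (below-top : ∀ q → One q → q ≺ top) where
    joinThrough : ∀ {p c d} → ChainBelow p c → One p → ChainAbove p d → ChainBelow top (suc (c + d))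
    joinThrough {p} {c} {zero} ch op anil =
      subst (ChainBelow top) (cong suc (sym (+-identityʳ c))) (dcons p (below-top p op) op ch)
    joinThrough {p} {c} {suc d} ch op (acons q p≺q oq rest) =
      subst (ChainBelow top) (cong suc (sym (+-suc c d))) (joinThrough (dcons p p≺q op ch) oq rest)

  -- depth i j: the length of a longest chain of ones inside [0 , i) × [0 , j),
  -- computed by the usual longest-chain recursion.
  depth : ℕ → ℕ → ℕ
  depth zero    j       = 0
  depth (suc i) zero    = 0
  depth (suc i) (suc j) = depth i (suc j) ⊔ depth (suc i) j ⊔ (depth i j + bit (B i j))

  depth-col0 : ∀ i → depth i 0 ≡ 0
  depth-col0 zero    = refl
  depth-col0 (suc i) = refl

  private
    +bit≤suc : ∀ x b → x + bit b ≤ suc x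
    +bit≤suc x b = ≤-trans (+-monoʳ-≤ x (bit≤1 b)) (≤-reflexive (+-comm x 1))

    depth-nextRow : ∀ i j → depth i j ≤ depth (suc i) j
    depth-nextRow zero    j       = z≤n
    depth-nextRow (suc i) zero    = ≤-refl
    depth-nextRow (suc i) (suc j) = ≤-trans (m≤m⊔n _ _) (m≤m⊔n _ _)

    depth-nextCol : ∀ i j → depth i j ≤ depth i (suc j)
    depth-nextCol zero    j = z≤n
    depth-nextCol (suc i) j = ≤-trans (m≤n⊔m (depth i (suc j)) _) (m≤m⊔n _ _)

    depth-monoRow : ∀ d i j → depth i j ≤ depth (d + i) j
    depth-monoRow zero    i j = ≤-refl
    depth-monoRow (suc d) i j = ≤-trans (depth-monoRow d i j) (depth-nextRow (d + i) j)

    depth-monoCol : ∀ d i j → depth i j ≤ depth i (d + j)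
    depth-monoCol zero    i j = ≤-refl
    depth-monoCol (suc d) i j = ≤-trans (depth-monoCol d i j) (depth-nextCol i (d + j))

    depth-addCol : ∀ i j → depth i (suc j) ≤ suc (depth i j)
    depth-addCol zero    j = z≤n
    depth-addCol (suc i) j =
      ⊔-lub (⊔-lub (≤-trans (depth-addCol i j) (s≤s (depth-nextRow i j))) (n≤1+n _))
            (≤-trans (+bit≤suc (depth i j) (B i j)) (s≤s (depth-nextRow i j)))

    depth-addRow : ∀ i j → depth (suc i) j ≤ suc (depth i j)
    depth-addRow i       zero    = z≤n
    depth-addRow zero    (suc j) = ⊔-lub (⊔-lub z≤n (depth-addRow zero j)) (+bit≤suc 0 (B 0 j))
    depth-addRow (suc i) (suc j) =
      ⊔-lub (⊔-lub (n≤1+n _) (≤-trans (depth-addRow (suc i) j) (s≤s (depth-nextCol (suc i) j))))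
            (≤-trans (+bit≤suc (depth (suc i) j) (B (suc i) j)) (s≤s (depth-nextCol (suc i) j)))

  depth-mono : ∀ {i j i' j'} → i ≤ i' → j ≤ j' → depth i j ≤ depth i' j'
  depth-mono {i} {j} {i'} {j'} i≤i' j≤j' =
    ≤-trans (subst (λ x → depth i j ≤ depth x j) (m∸n+n≡m i≤i') (depth-monoRow (i' ∸ i) i j))
            (subst (λ x → depth i' j ≤ depth i' x) (m∸n+n≡m j≤j') (depth-monoCol (j' ∸ j) i' j))

  depth-diagStep : ∀ i j → depth (suc i) (suc j) ≤ suc (depth i j)
  depth-diagStep i j = ⊔-lub (⊔-lub (depth-addCol i j) (depth-addRow i j)) (+bit≤suc (depth i j) (B i j))

  depth≤row : ∀ i j → depth i j ≤ i
  depth≤row zero    j       = z≤n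
  depth≤row (suc i) zero    = z≤n
  depth≤row (suc i) (suc j) =
    ⊔-lub (⊔-lub (≤-trans (depth≤row i (suc j)) (n≤1+n i)) (depth≤row (suc i) j))
          (≤-trans (+bit≤suc (depth i j) (B i j)) (s≤s (depth≤row i j)))

  depth≤col : ∀ i j → depth i j ≤ j
  depth≤col zero    j       = z≤n
  depth≤col (suc i) zero    = z≤n
  depth≤col (suc i) (suc j) =
    ⊔-lub (⊔-lub (depth≤col i (suc j)) (≤-trans (depth≤col (suc i) j) (n≤1+n j)))
          (≤-trans (+bit≤suc (depth i j) (B i j)) (s≤s (depth≤col i j)))

  depth-one< : ∀ {q p} → q ≺ p → One q → suc (depth (proj₁ q) (proj₂ q)) ≤ depth (proj₁ p) (proj₂ p)
  depth-one< {qi , qj} (qi<pi , qj<pj) oq =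
    ≤-trans (≤-trans (≤-reflexive (trans (+-comm 1 (depth qi qj))
                                         (cong (λ b → depth qi qj + bit b) (sym oq))))
                     (m≤n⊔m (depth qi (suc qj) ⊔ depth (suc qi) qj) _))
            (depth-mono qi<pi qj<pj)

  depth-sound : ∀ {p c} → ChainBelow p c → c ≤ depth (proj₁ p) (proj₂ p)
  depth-sound dnil                 = z≤n
  depth-sound (dcons q q≺p oq ch) = ≤-trans (s≤s (depth-sound ch)) (depth-one< q≺p oq)

  depth-chain : ∀ i j → ChainBelow (i , j) (depth i j)
  depth-chain zero    j       = dnil
  depth-chain (suc i) zero    = dnil
  depth-chain (suc i) (suc j) with ⊔-sel (depth i (suc j) ⊔ depth (suc i) j) (depth i j + bit (B i j))
  ... | inj₂ e = subst (ChainBelow _) (sym e) (throughCorner (B i j) refl)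
    where
    throughCorner : ∀ b → B i j ≡ b → ChainBelow (suc i , suc j) (depth i j + bit b)
    throughCorner true  eq = subst (ChainBelow _) (+-comm 1 (depth i j))
                               (dcons (i , j) (≤-refl , ≤-refl) eq (depth-chain i j))
    throughCorner false eq = subst (ChainBelow _) (sym (+-identityʳ (depth i j)))
                               (ChainBelow-widen (depth-chain i j) (n≤1+n i , n≤1+n j))
  ... | inj₁ e with ⊔-sel (depth i (suc j)) (depth (suc i) j)
  ...   | inj₁ e' = subst (ChainBelow _) (sym (trans e e'))
                      (ChainBelow-widen (depth-chain i (suc j)) (n≤1+n i , ≤-refl))
  ...   | inj₂ e' = subst (ChainBelow _) (sym (trans e e'))
                      (ChainBelow-widen (depth-chain (suc i) j) (≤-refl , n≤1+n j))

Pattern : (k : ℕ) {m n : ℕ} → Matrix m n → Set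
Pattern k {m} {n} A =
  Σ (Fin k → Fin m) λ r → Σ (Fin k → Fin n) λ c →
    StrictlyIncreasing r × StrictlyIncreasing c × ((t : Fin k) → A (r t) (c t) ≡ true)

module InPlane {m n : ℕ} (A : Matrix m n) where

  B : ℕ → ℕ → Bool
  B i j with i <? m | j <? n
  ... | yes i<m | yes j<n = A (fromℕ< i<m) (fromℕ< j<n)
  ... | _       | _       = false

  B-inside : ∀ i j → B i j ≡ true → i < m × j < n
  B-inside i j e with i <? m | j <? n
  ... | yes i<m | yes j<n = i<m , j<n
  B-inside i j () | yes _ | no _
  B-inside i j () | no _  | _

  B-agrees : ∀ (i : Fin m) (j : Fin n) → B (toℕ i) (toℕ j) ≡ A i j
  B-agrees i j with toℕ i <? m | toℕ j <? n
  ... | yes i<m | yes j<n = cong₂ A (FP.fromℕ<-toℕ i i<m) (FP.fromℕ<-toℕ j j<n)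
  ... | yes _   | no j≮n  = ⊥-elim (j≮n (FP.toℕ<n j))
  ... | no i≮m  | _       = ⊥-elim (i≮m (FP.toℕ<n i))

  open Chains B public

  corner : Pt
  corner = (m , n)

  below-corner : ∀ q → One q → q ≺ corner
  below-corner (i , j) = B-inside i j

  open Join corner below-corner public

  -- The matrix rotated by 180°: chains above a point become chains below the
  -- rotated point, so the rotated depth measures chains above.
  private
    Brot : ℕ → ℕ → Bool
    Brot u v = B (m ∸ suc u) (n ∸ suc v)

  module Rot = Chains Brot

  -- height i j: the length of a longest chain of ones strictly south-east of (i , j)
  height : ℕ → ℕ → ℕ
  height i j = Rot.depth (m ∸ suc i) (n ∸ suc j)

  private
    flip-flip : ∀ {x M} → x < M → M ∸ suc (M ∸ suc x) ≡ x
    flip-flip {x} {suc M} (s≤s x≤M) = m∸[m∸n]≡n x≤M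

    flip-< : ∀ {x y M} → x < y → y < M → M ∸ suc y < M ∸ suc x
    flip-< x<y y<M = ∸-monoʳ-< (s≤s x<y) y<M

    flip-bound : ∀ {x M} → x < M → M ∸ suc x < M
    flip-bound {x} {suc M} _ = s≤s (m∸n≤m M x)

    toRot : ∀ {i j c} → ChainAbove (i , j) c → Rot.ChainBelow (m ∸ suc i , n ∸ suc j) c
    toRot anil = Rot.dnil
    toRot (acons (i₂ , j₂) (i<i₂ , j<j₂) o rest) =
      Rot.dcons (m ∸ suc i₂ , n ∸ suc j₂) (flip-< i<i₂ i₂<m , flip-< j<j₂ j₂<n)
        (subst₂ (λ x y → B x y ≡ true) (sym (flip-flip i₂<m)) (sym (flip-flip j₂<n)) o) (toRot rest)
      where
      i₂<m : i₂ < m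
      i₂<m = proj₁ (B-inside i₂ j₂ o)
      j₂<n : j₂ < n
      j₂<n = proj₂ (B-inside i₂ j₂ o)

    fromRot : ∀ {u v c} → u < m → v < n → Rot.ChainBelow (u , v) c → ChainAbove (m ∸ suc u , n ∸ suc v) c
    fromRot _ _ Rot.dnil = anil
    fromRot u<m v<n (Rot.dcons (u₂ , v₂) (u₂<u , v₂<v) o rest) =
      acons (m ∸ suc u₂ , n ∸ suc v₂) (flip-< u₂<u u<m , flip-< v₂<v v<n) o
            (fromRot (<-trans u₂<u u<m) (<-trans v₂<v v<n) rest)

  height-sound : ∀ {i j c} → ChainAbove (i , j) c → c ≤ height i j
  height-sound ch = Rot.depth-sound (toRot ch)

  height-chain : ∀ i j → i < m → j < n → ChainAbove (i , j) (height i j)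
  height-chain i j i<m j<n =
    subst₂ (λ x y → ChainAbove (x , y) (height i j)) (flip-flip i<m) (flip-flip j<n)
      (fromRot (flip-bound i<m) (flip-bound j<n) (Rot.depth-chain (m ∸ suc i) (n ∸ suc j)))

  -- A chain of k ones below the corner is a k-pattern of A, listed backwards.
  chain⇒pattern : ∀ {k} → ChainBelow corner k → Pattern k A
  chain⇒pattern {k} ch = row ∘ entry , col ∘ entry , rows↑ , cols↑ , entries-one
    where
    nth : ∀ {p c} → ChainBelow p c → Fin c → Σ Pt λ q → One q × q ≺ p
    nth (dcons q q≺p oq _)    F.zero    = q , oq , q≺p
    nth (dcons q q≺p _  rest) (F.suc u) with nth rest u
    ... | q' , oq' , q'≺q = q' , oq' , ≺-≼-trans q'≺q (≺⇒≼ q≺p)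
    nth-desc : ∀ {p c} (ch : ChainBelow p c) (u v : Fin c) → toℕ u < toℕ v →
               proj₁ (nth ch v) ≺ proj₁ (nth ch u)
    nth-desc (dcons q _ _ rest) F.zero    (F.suc v) _        = proj₂ (proj₂ (nth rest v))
    nth-desc (dcons q _ _ rest) (F.suc u) (F.suc v) (s≤s lt) = nth-desc rest u v lt
    entry : Fin k → Σ Pt λ q → One q × q ≺ corner
    entry t = nth ch (opposite t)
    row : (Σ Pt λ q → One q × q ≺ corner) → Fin m
    row (_ , _ , i<m , _) = fromℕ< i<m
    col : (Σ Pt λ q → One q × q ≺ corner) → Fin n
    col (_ , _ , _ , j<n) = fromℕ< j<n
    opposite-< : ∀ (s t : Fin k) → toℕ s < toℕ t → toℕ (opposite t) < toℕ (opposite s)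
    opposite-< s t lt = subst₂ _<_ (sym (FP.opposite-prop t)) (sym (FP.opposite-prop s))
                          (∸-monoʳ-< (s≤s lt) (FP.toℕ<n t))
    rows↑ : StrictlyIncreasing (row ∘ entry)
    rows↑ s t lt = subst₂ _<_ (sym (FP.toℕ-fromℕ< _)) (sym (FP.toℕ-fromℕ< _))
                     (proj₁ (nth-desc ch (opposite t) (opposite s) (opposite-< s t lt)))
    cols↑ : StrictlyIncreasing (col ∘ entry)
    cols↑ s t lt = subst₂ _<_ (sym (FP.toℕ-fromℕ< _)) (sym (FP.toℕ-fromℕ< _))
                     (proj₂ (nth-desc ch (opposite t) (opposite s) (opposite-< s t lt)))
    entries-one : ∀ t → A (row (entry t)) (col (entry t)) ≡ true
    entries-one t with entry t
    ... | (i , j) , oq , i<m , j<n =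
      trans (sym (B-agrees (fromℕ< i<m) (fromℕ< j<n)))
            (trans (cong₂ B (FP.toℕ-fromℕ< i<m) (FP.toℕ-fromℕ< j<n)) oq)

  ChainBelow-shorten : ∀ {p c d} → ChainBelow p c → d ≤ c → ChainBelow p d
  ChainBelow-shorten {d = zero} _ _ = dnil
  ChainBelow-shorten {c = suc c} {d = suc d} ch (s≤s d≤c) with d ≟ c
  ... | yes refl = ch
  ... | no d≢c with ch
  ...   | dcons q q≺p _ rest = ChainBelow-widen (ChainBelow-shorten rest (≤∧≢⇒< d≤c d≢c)) (≺⇒≼ q≺p)

-- Avoiding matrices: slack, and adding a one.  A position (i , j) has slack
-- when  depth i j + 1 + height i j < k.

module Slack {m n : ℕ} (A : Matrix m n) (k : ℕ) (av : Avoiding k A) where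
  open InPlane A

  chain<k : ∀ {c} → ChainBelow corner c → c < k
  chain<k {c} ch with k ≤? c
  ... | no k≰c  = ≰⇒> k≰c
  ... | yes k≤c = ⊥-elim (av (chain⇒pattern (ChainBelow-shorten ch k≤c)))

  -- Every one has slack: it lies on a chain of length  depth + 1 + height.
  one-slack : ∀ i j → One (i , j) → suc (depth i j + height i j) < k
  one-slack i j o = chain<k (joinThrough (depth-chain i j) o (height-chain i j i<m j<n))
    where
    i<m : i < m
    i<m = proj₁ (B-inside i j o)
    j<n : j < n
    j<n = proj₂ (B-inside i j o)

  -- If the depth jumps at the diagonal step (i,j) → (i+1,j+1), the top one z of
  -- a longest chain below (i+1,j+1) satisfies z ≼ (i,j) and has depth i j ones
  -- below it; the chain through z then shows that (i , j) has slack.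
  depthJump-slack : ∀ i j → suc i < m → suc j < n → depth (suc i) (suc j) ≡ suc (depth i j) →
                    suc (depth i j + height i j) < k
  depthJump-slack i j i+1<m j+1<n jump
    with subst (ChainBelow (suc i , suc j)) jump (depth-chain (suc i) (suc j))
  ... | dcons z (zi≤i , zj≤j) oz rest =
    chain<k (joinThrough rest oz
      (ChainAbove-widen (height-chain i j (<-trans (n<1+n i) i+1<m) (<-trans (n<1+n j) j+1<n))
                        (≤-pred zi≤i , ≤-pred zj≤j)))

  heightDrop-slack : ∀ i j → suc i < m → suc j < n → height i j ≡ suc (height (suc i) (suc j)) →
                     suc (depth (suc i) (suc j) + height (suc i) (suc j)) < k
  heightDrop-slack i j i+1<m j+1<n drop
    with subst (ChainAbove (i , j)) drop (height-chain i j (<-trans (n<1+n i) i+1<m) (<-trans (n<1+n j) j+1<n))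
  ... | acons z (i<zi , j<zj) oz rest =
    chain<k (joinThrough (ChainBelow-widen (depth-chain (suc i) (suc j)) (i<zi , j<zj)) oz rest)

setOne-other : ∀ {m n} (A : Matrix m n) (i : Fin m) (j : Fin n) i' j' →
               ¬ (i' ≡ i × j' ≡ j) → setOne A i j i' j' ≡ A i' j'
setOne-other A i j i' j' ne with i F.≟ i' | j F.≟ j'
... | yes refl | yes refl = ⊥-elim (ne (refl , refl))
... | yes _    | no _     = refl
... | no _     | yes _    = refl
... | no _     | no _     = refl

setOne-same : ∀ {m n} (A : Matrix m n) (i : Fin m) (j : Fin n) → setOne A i j i j ≡ true
setOne-same A i j with i F.≟ i | j F.≟ j
... | yes _ | yes _ = refl
... | no ne | _     = ⊥-elim (ne refl)
... | yes _ | no ne = ⊥-elim (ne refl)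

StrictlyIncreasing-injective : ∀ {k m} {f : Fin k → Fin m} → StrictlyIncreasing f →
                               ∀ s t → f s ≡ f t → s ≡ t
StrictlyIncreasing-injective f↑ s t e with FP.<-cmp s t
... | tri≈ _ s≡t _ = s≡t
... | tri< s<t _ _ = ⊥-elim (<-irrefl (cong toℕ e) (f↑ s t s<t))
... | tri> _ _ t<s = ⊥-elim (<-irrefl (cong toℕ (sym e)) (f↑ t s t<s))

module AddOne {m n : ℕ} (A : Matrix m n) (k : ℕ) (av : Avoiding k A) where
  open InPlane A

  module Split (r : Fin k → Fin m) (c : Fin k → Fin n) (r↑ : StrictlyIncreasing r)
               (c↑ : StrictlyIncreasing c) (s : Fin k)
               (one : ∀ t → toℕ t ≢ toℕ s → One (toℕ (r t) , toℕ (c t))) where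

    pos : Fin k → Pt
    pos t = (toℕ (r t) , toℕ (c t))

    private
      at : ∀ u → u < k → Pt
      at u u<k = pos (fromℕ< u<k)

      at-≺ : ∀ u (u<k : u < k) (u+1<k : suc u < k) → at u u<k ≺ at (suc u) u+1<k
      at-≺ u u<k u+1<k = r↑ _ _ lt , c↑ _ _ lt
        where
        lt : toℕ (fromℕ< u<k) < toℕ (fromℕ< u+1<k)
        lt = subst₂ _<_ (sym (FP.toℕ-fromℕ< u<k)) (sym (FP.toℕ-fromℕ< u+1<k)) (n<1+n u)

      at-one : ∀ u (u<k : u < k) → u ≢ toℕ s → One (at u u<k)
      at-one u u<k u≢s = one (fromℕ< u<k) (u≢s ∘ trans (sym (FP.toℕ-fromℕ< u<k)))

      prefix-at : ∀ u (u<k : u < k) → u ≤ toℕ s → ChainBelow (at u u<k) u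
      prefix-at zero    _     _ = dnil
      prefix-at (suc u) u+1<k le =
        dcons (at u u<k) (at-≺ u u<k u+1<k) (at-one u u<k (<⇒≢ le)) (prefix-at u u<k (≤-trans (n≤1+n u) le))
        where
        u<k : u < k
        u<k = <-trans (n<1+n u) u+1<k

      suffix-at : ∀ d u (u<k : u < k) → u + d < k → toℕ s ≤ u → ChainAbove (at u u<k) d
      suffix-at zero    u _   _   _  = anil
      suffix-at (suc d) u u<k lim le =
        acons (at (suc u) u+1<k) (at-≺ u u<k u+1<k) (at-one (suc u) u+1<k (≢-sym (<⇒≢ (s≤s le))))
              (suffix-at d (suc u) u+1<k (subst (_< k) (+-suc u d) lim) (≤-trans le (n≤1+n u)))
        where
        u+1<k : suc u < k
        u+1<k = ≤-<-trans (s≤s (m≤m+n u d)) (subst (_< k) (+-suc u d) lim)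

      at-s : at (toℕ s) (FP.toℕ<n s) ≡ pos s
      at-s = cong pos (FP.fromℕ<-toℕ s (FP.toℕ<n s))

    prefix : ChainBelow (pos s) (toℕ s)
    prefix = subst (λ p → ChainBelow p (toℕ s)) at-s (prefix-at (toℕ s) (FP.toℕ<n s) ≤-refl)

    suffix : ChainAbove (pos s) (k ∸ suc (toℕ s))
    suffix = subst (λ p → ChainAbove p (k ∸ suc (toℕ s))) at-s
               (suffix-at (k ∸ suc (toℕ s)) (toℕ s) (FP.toℕ<n s)
                  (≤-reflexive (m+[n∸m]≡n (FP.toℕ<n s))) ≤-refl)

  -- A position with slack can be set to one: a pattern of the new matrix must
  -- pass through it, and splitting it there yields chains of lengths s and
  -- k - 1 - s below and above the position.
  setOne-avoiding : (i₀ : Fin m) (j₀ : Fin n) →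
    suc (depth (toℕ i₀) (toℕ j₀) + height (toℕ i₀) (toℕ j₀)) < k → Avoiding k (setOne A i₀ j₀)
  setOne-avoiding i₀ j₀ slack (r , c , r↑ , c↑ , on)
    with FP.any? (λ s → (r s F.≟ i₀) ×-dec (c s F.≟ j₀))
  ... | no misses = av (r , c , r↑ , c↑ , λ t →
          trans (sym (setOne-other A i₀ j₀ (r t) (c t) (λ e → misses (t , e)))) (on t))
  ... | yes (s , rs≡i₀ , cs≡j₀) =
    <-irrefl refl (≤-<-trans (≤-trans (≤-reflexive (sym (m+[n∸m]≡n (FP.toℕ<n s))))
                                      (s≤s (+-mono-≤ prefix≤depth suffix≤height)))
                             slack)
    where
    one : ∀ t → toℕ t ≢ toℕ s → One (toℕ (r t) , toℕ (c t))
    one t t≢s = trans (B-agrees (r t) (c t))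
      (trans (sym (setOne-other A i₀ j₀ (r t) (c t)
                     (λ (e , _) → t≢s (cong toℕ (StrictlyIncreasing-injective r↑ t s (trans e (sym rs≡i₀)))))))
             (on t))
    open Split r c r↑ c↑ s one
    pos-s : pos s ≡ (toℕ i₀ , toℕ j₀)
    pos-s = cong₂ _,_ (cong toℕ rs≡i₀) (cong toℕ cs≡j₀)
    prefix≤depth : toℕ s ≤ depth (toℕ i₀) (toℕ j₀)
    prefix≤depth = subst (λ p → toℕ s ≤ depth (proj₁ p) (proj₂ p)) pos-s (depth-sound prefix)
    suffix≤height : k ∸ suc (toℕ s) ≤ height (toℕ i₀) (toℕ j₀)
    suffix≤height = subst (λ p → k ∸ suc (toℕ s) ≤ height (proj₁ p) (proj₂ p)) pos-s (height-sound suffix)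

-- The diagonal walk
--
-- Positions s < L of a diagonal carry a depth α s and a height β s.  The
-- hypotheses are the properties of depth and height along a diagonal starting
-- on the border, plus saturation: every position with slack is a one.

private
  ≤-pred∸ : ∀ {s M} → s < M → s ≤ M ∸ 1
  ≤-pred∸ {s} {suc M} = ≤-pred

  pred∸< : ∀ {s M} → s < M → M ∸ 1 < M
  pred∸< {s} {suc M} _ = n<1+n M

  suc<∸ : ∀ {s M} → s < M ∸ 1 → suc s < M
  suc<∸ {s} {suc M} = s≤s

module DiagonalWalk (k L : ℕ) (α β : ℕ → ℕ) (One : ℕ → Set)
  (α-start : α 0 ≡ 0)
  (α-mono : ∀ s s' → s ≤ s' → α s ≤ α s')
  (α-step : ∀ s → α (suc s) ≤ suc (α s))
  (β-end : β (L ∸ 1) ≡ 0)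
  (β-anti : ∀ s s' → s ≤ s' → β s' ≤ β s)
  (β-step : ∀ s → β s ≤ suc (β (suc s)))
  (α-jump-slack : ∀ s → suc s < L → α (suc s) ≡ suc (α s) → suc (α s + β s) < k)
  (β-drop-slack : ∀ s → suc s < L → β s ≡ suc (β (suc s)) → suc (α (suc s) + β (suc s)) < k)
  (ones-α↑ : ∀ s s' → s < s' → One s → α s < α s')
  (slack⇒one : ∀ s → s < L → suc (α s + β s) < k → One s)
  where

  heightDrop-one : ∀ s₀ w → s₀ < L → β s₀ ≡ suc w →
                   Σ ℕ λ s₁ → s₀ < s₁ × s₁ < L × β s₁ ≡ w × One s₁
  heightDrop-one s₀ w s₀<L βs₀≡ =
    let (s , s₀≤s , s<L-1 , βs≰w , βs+1≤w) = firstSwitch (λ s → β s ≤ w) (λ s → β s ≤? w) s₀ (L ∸ 1)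
          (≤-pred∸ s₀<L) (λ le → 1+n≰n (subst (_≤ w) βs₀≡ le)) (subst (_≤ w) (sym β-end) z≤n)
        βs≡ : β s ≡ suc w
        βs≡ = ≤-antisym (subst (β s ≤_) βs₀≡ (β-anti s₀ s s₀≤s)) (≰⇒> βs≰w)
        βs+1≡ : β (suc s) ≡ w
        βs+1≡ = ≤-antisym βs+1≤w (≤-pred (subst (_≤ suc (β (suc s))) βs≡ (β-step s)))
    in suc s , s≤s s₀≤s , suc<∸ s<L-1 , βs+1≡ ,
       slack⇒one (suc s) (suc<∸ s<L-1) (β-drop-slack s (suc<∸ s<L-1) (trans βs≡ (cong suc (sym βs+1≡))))

  module _ (t : ℕ) (t+1<k : suc t < k) where

    -- Following the height drops from a one s₀ of height w with k ≤ α s₀ + w + 2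
    -- keeps this invariant (α grows along ones) and ends at a one of depth ≥ k - 2 ≥ t.
    descend : ∀ w s₀ → s₀ < L → β s₀ ≡ w → One s₀ → k ≤ suc (suc (α s₀ + w)) →
              Σ ℕ λ s → s < L × One s × t ≤ α s
    descend zero s₀ s₀<L _ o inv =
      s₀ , s₀<L , o , ≤-pred (≤-pred (≤-trans t+1<k (subst (λ x → k ≤ suc (suc x)) (+-identityʳ (α s₀)) inv)))
    descend (suc w) s₀ s₀<L βs₀≡ o inv with heightDrop-one s₀ w s₀<L βs₀≡
    ... | s₁ , s₀<s₁ , s₁<L , βs₁≡ , o₁ = descend w s₁ s₁<L βs₁≡ o₁
          (≤-trans inv (s≤s (s≤s (≤-trans (≤-reflexive (+-suc (α s₀) w))
                                          (+-monoˡ-≤ w (ones-α↑ s₀ s₁ s₀<s₁ o))))))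

    all-ones⇒index≤α : (∀ s → s < L → One s) → ∀ s → s < L → s ≤ α s
    all-ones⇒index≤α allOne zero    _   = z≤n
    all-ones⇒index≤α allOne (suc s) s<L = ≤-trans (s≤s (all-ones⇒index≤α allOne s s-1<L))
                                                (ones-α↑ s (suc s) (n<1+n s) (allOne s s-1<L))
      where
      s-1<L : s < L
      s-1<L = <-trans (n<1+n s) s<L

    -- Some one has depth ≥ t: either every position has slack (so all are ones),
    -- or some position s* has none and descending from below it reaches depth ≥ t.
    reach : t < L → (∀ s → s < L → α s ≤ t) → Σ ℕ λ s → s < L × One s × t ≤ α s
    reach t<L α≤t with search (λ s → k ≤ suc (α s + β s)) (λ s → k ≤? suc (α s + β s)) L
    ... | inj₂ all-slack =
      L ∸ 1 , pred∸< t<L , allOne (L ∸ 1) (pred∸< t<L) ,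
      ≤-trans (≤-pred∸ t<L) (all-ones⇒index≤α allOne (L ∸ 1) (pred∸< t<L))
      where
      allOne : ∀ s → s < L → One s
      allOne s s<L = slack⇒one s s<L (≰⇒> (all-slack s s<L))
    ... | inj₁ (s* , s*<L , no-slack) with β s* in βs*≡
    ...   | zero = ⊥-elim (1+n≰n (≤-trans t+1<k (≤-trans (subst (λ x → k ≤ suc x) (+-identityʳ (α s*)) no-slack)
                                                       (s≤s (α≤t s* s*<L)))))
    ...   | suc w with heightDrop-one s* w s*<L βs*≡
    ...     | s₁ , s*<s₁ , s₁<L , βs₁≡ , o₁ = descend w s₁ s₁<L βs₁≡ o₁
              (≤-trans no-slack (s≤s (≤-trans (≤-reflexive (+-suc (α s*) w))
                                              (s≤s (+-monoˡ-≤ w (α-mono s* s₁ (<⇒≤ s*<s₁)))))))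

    -- Level t is attained: at the first jump of α past t if there is one,
    -- otherwise by `reach`.
    level-attained : t < L → Σ ℕ λ s → s < L × One s × α s ≡ t
    level-attained t<L with search (λ s → t < α s) (λ s → t <? α s) L
    ... | inj₁ (s' , s'<L , t<αs') =
      let (s , _ , s<s' , αs≯t , t<αs+1) = firstSwitch (λ s → t < α s) (λ s → t <? α s) 0 s' z≤n
                                             (λ p → n≮0 (subst (t <_) α-start p)) t<αs'
          s+1<L : suc s < L
          s+1<L = ≤-<-trans s<s' s'<L
          αs≡t : α s ≡ t
          αs≡t = ≤-antisym (≮⇒≥ αs≯t) (≤-pred (≤-trans t<αs+1 (α-step s)))
          jump : α (suc s) ≡ suc (α s)
          jump = ≤-antisym (α-step s) (subst (λ x → suc x ≤ α (suc s)) (sym αs≡t) t<αs+1)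
      in s , <-trans (n<1+n s) s+1<L , slack⇒one s (<-trans (n<1+n s) s+1<L) (α-jump-slack s s+1<L jump) , αs≡t
    ... | inj₂ α≤t with reach t<L (λ s s<L → ≮⇒≥ (α≤t s s<L))
    ...   | s , s<L , o , t≤αs = s , s<L , o , ≤-antisym (≮⇒≥ (α≤t s s<L)) t≤αs

-- The layers of an avoiding matrix

module Layers {m n k : ℕ} (1≤k : 1 ≤ k) (k≤m : k ≤ m) (k≤n : k ≤ n)
              (A : Matrix m n) (av : Avoiding k A) where
  open InPlane A
  open Slack A k av

  K : ℕ
  K = k ∸ 1

  bound : ℕ
  bound = K * (m + n ∸ K)

  private
    K<k : K < k
    K<k = ∸-monoʳ-< {k} {1} {0} (s≤s z≤n) 1≤k

    t<m : ∀ {t} → t < K → t < m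
    t<m t<K = <-trans t<K (<-≤-trans K<k k≤m)

    t<n : ∀ {t} → t < K → t < n
    t<n t<K = <-trans t<K (<-≤-trans K<k k≤n)

  depthAt : Fin m → Fin n → ℕ
  depthAt i j = depth (toℕ i) (toℕ j)

  one-at : ∀ i j → A i j ≡ true → One (toℕ i , toℕ j)
  one-at i j e = trans (B-agrees i j) e

  one-depth<K : ∀ i j → A i j ≡ true → depthAt i j < K
  one-depth<K i j e = ≤-trans (s≤s ≤-refl)
    (∸-monoˡ-≤ 1 (≤-<-trans (s≤s (m≤m+n _ _)) (one-slack (toℕ i) (toℕ j) (one-at i j e))))

  inLayer : ℕ → Fin m → Fin n → Bool
  inLayer t i j = A i j ∧ (depthAt i j ≡ᵇ t)

  inLayer⁻ : ∀ t i j → inLayer t i j ≡ true → A i j ≡ true × depthAt i j ≡ t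
  inLayer⁻ t i j e with A i j | depthAt i j ≡ᵇ t in eq
  ... | true | true = refl , ≡ᵇ⇒≡ (depthAt i j) t (subst T (sym eq) tt)

  inLayer⁺ : ∀ t i j → A i j ≡ true → depthAt i j ≡ t → inLayer t i j ≡ true
  inLayer⁺ t i j e d with A i j
  ... | true = T⇒≡true (≡⇒≡ᵇ (depthAt i j) t d)
    where
    T⇒≡true : ∀ {b} → T b → b ≡ true
    T⇒≡true {true} _ = refl

  layer : ℕ → List (Fin m × Fin n)
  layer t = trueCells m n (inLayer t)

  layer-ones : ∀ t i j → (i , j) ∈ layer t → A i j ≡ true
  layer-ones t i j x∈ = proj₁ (inLayer⁻ t i j (∈-trueCells⁻ m n (inLayer t) x∈))

  layer-depth : ∀ t i j → (i , j) ∈ layer t → depthAt i j ≡ t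
  layer-depth t i j x∈ = proj₂ (inLayer⁻ t i j (∈-trueCells⁻ m n (inLayer t) x∈))

  one-layer : ∀ i j → A i j ≡ true →
              Σ (Fin K) λ t → (i , j) ∈ layer (toℕ t) × ((t' : Fin K) → (i , j) ∈ layer (toℕ t') → t' ≡ t)
  one-layer i j e =
    fromℕ< d<K , ∈-trueCells⁺ m n (inLayer _) (inLayer⁺ _ i j e (sym (FP.toℕ-fromℕ< d<K))) ,
    λ t' x∈ → FP.toℕ-injective (trans (sym (layer-depth (toℕ t') i j x∈)) (sym (FP.toℕ-fromℕ< d<K)))
    where
    d<K : depthAt i j < K
    d<K = one-depth<K i j e

  ones≡Σlayers : ones A ≡ sumFin K (λ t → length (layer (toℕ t)))
  ones≡Σlayers = begin
      sumFin m (λ i → sumFin n (λ j → bit (A i j)))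
    ≡⟨ sum-cong m (λ i → sum-cong n (λ j → split i j)) ⟩
      sumFin m (λ i → sumFin n (λ j → sumFin K (λ t → bit (inLayer (toℕ t) i j))))
    ≡⟨ sum-cong m (λ i → sum-swap n K (λ j t → bit (inLayer (toℕ t) i j))) ⟩
      sumFin m (λ i → sumFin K (λ t → sumFin n (λ j → bit (inLayer (toℕ t) i j))))
    ≡⟨ sum-swap m K (λ i t → sumFin n (λ j → bit (inLayer (toℕ t) i j))) ⟩
      sumFin K (λ t → sumFin m (λ i → sumFin n (λ j → bit (inLayer (toℕ t) i j))))
    ≡⟨ sum-cong K (λ t → sym (length-trueCells m n (inLayer (toℕ t)))) ⟩
      sumFin K (λ t → length (layer (toℕ t)))
    ∎
    where
    open ≡-Reasoning
    split : ∀ i j → bit (A i j) ≡ sumFin K (λ t → bit (inLayer (toℕ t) i j))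
    split i j with A i j in eq
    ... | true  = sym (sum-indicator K (depthAt i j) (one-depth<K i j eq))
    ... | false = sym (sum-zero K (λ _ → refl))

  -- The anti-diagonal key of a cell: one step left or down raises it by one.
  key : Fin m × Fin n → ℕ
  key (i , j) = (n ∸ toℕ j) + toℕ i

  LayerOrder : Fin m × Fin n → Fin m × Fin n → Set
  LayerOrder (i , j) (i' , j') = toℕ i ≤ toℕ i' × toℕ j' ≤ toℕ j × key (i , j) < key (i' , j')

  -- Two ones of a layer are never strictly north-west of each other (depth-one<),
  -- so the row-major order of the layer is a LayerOrder.
  layer-sorted : ∀ t → AllPairs LayerOrder (layer t)
  layer-sorted t = AllPairs-onMembers (trueCells-sorted m n (inLayer t)) ordered
    where
    ordered : ∀ {x y} → x ∈ layer t → y ∈ layer t → CellBefore x y → LayerOrder x y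
    ordered {i , j} {i' , j'} x∈ y∈ (inj₁ i<i') = <⇒≤ i<i' , j'≤j , +-mono-≤-< (∸-monoʳ-≤ n j'≤j) i<i'
      where
      j'≤j : toℕ j' ≤ toℕ j
      j'≤j with toℕ j' ≤? toℕ j
      ... | yes le = le
      ... | no j'≰j = ⊥-elim (<-irrefl (trans (layer-depth t i j x∈) (sym (layer-depth t i' j' y∈)))
                        (depth-one< (i<i' , ≰⇒> j'≰j) (one-at i j (layer-ones t i j x∈))))
    ordered {i , j} {.i , j'} x∈ y∈ (inj₂ (refl , j'<j)) =
      ≤-refl , <⇒≤ j'<j , +-monoˡ-< (toℕ i) (∸-monoʳ-< j'<j (<⇒≤ (FP.toℕ<n j)))

  layer-keys↑ : ∀ t → AllPairs (Keyed.KeyLess key) (layer t)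
  layer-keys↑ t = AP.map (proj₂ ∘ proj₂) (layer-sorted t)

  -- Keys of layer t lie in [t + 1 , (n - t) + (m - 1)], since depth ≤ row, column.
  lo hi : ℕ → ℕ
  lo t = suc t
  hi t = (n ∸ t) + (m ∸ 1)

  layer-inRange : ∀ t → All (Keyed.InRange key (lo t) (hi t)) (layer t)
  layer-inRange t = All.tabulate inRange
    where
    inRange : ∀ {x} → x ∈ layer t → Keyed.InRange key (lo t) (hi t) x
    inRange {i , j} x∈ = +-mono-≤ (≤-trans (s≤s z≤n) (1≤n∸j (FP.toℕ<n j))) t≤i ,
                         +-mono-≤ (∸-monoʳ-≤ n t≤j) (≤-pred∸ (FP.toℕ<n i))
      where
      t≤i : t ≤ toℕ i
      t≤i = subst (_≤ toℕ i) (layer-depth t i j x∈) (depth≤row (toℕ i) (toℕ j))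
      t≤j : t ≤ toℕ j
      t≤j = subst (_≤ toℕ j) (layer-depth t i j x∈) (depth≤col (toℕ i) (toℕ j))
      1≤n∸j : ∀ {x} → x < n → 1 ≤ n ∸ x
      1≤n∸j {x} x<n = subst (_≤ n ∸ x) (trans (+-∸-assoc 1 (≤-refl {x})) (cong suc (n∸n≡0 x))) (∸-monoˡ-≤ x x<n)

  cap : ℕ → ℕ
  cap t = m + n ∸ (2 * t + 1)

  range-size : ∀ t → t < K → suc (hi t) ∸ lo t ≡ cap t
  range-size t t<K =
    subst₂ (λ m' n' → ((n' ∸ t) + (m' ∸ 1)) ∸ t ≡ m' + n' ∸ (2 * t + 1))
      (m+[n∸m]≡n (t<m t<K)) (m+[n∸m]≡n (<⇒≤ (t<n t<K))) (shifted (n ∸ t) (m ∸ suc t))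
    where
    shifted : ∀ a b → (((t + a) ∸ t) + (suc t + b ∸ 1)) ∸ t ≡ (suc t + b) + (t + a) ∸ (2 * t + 1)
    shifted a b = begin
      (((t + a) ∸ t) + (t + b)) ∸ t     ≡⟨ cong (λ x → (x + (t + b)) ∸ t) (m+n∸m≡n t a) ⟩
      (a + (t + b)) ∸ t                 ≡⟨ cong (_∸ t) (solve 3 (λ t a b → a :+ (t :+ b) := t :+ (a :+ b)) refl t a b) ⟩
      (t + (a + b)) ∸ t                 ≡⟨ m+n∸m≡n t (a + b) ⟩
      a + b                             ≡⟨ sym (m+n∸m≡n (2 * t + 1) (a + b)) ⟩
      ((2 * t + 1) + (a + b)) ∸ (2 * t + 1)
        ≡⟨ cong (_∸ (2 * t + 1)) (solve 3 (λ t a b → (con 2 :* t :+ con 1) :+ (a :+ b)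
                                                   := (con 1 :+ t :+ b) :+ (t :+ a)) refl t a b) ⟩
      (suc t + b) + (t + a) ∸ (2 * t + 1) ∎
      where open ≡-Reasoning

  layer-length≤ : ∀ t → t < K → length (layer t) ≤ cap t
  layer-length≤ t t<K = subst (length (layer t) ≤_) (range-size t t<K)
                          (Keyed.length-≤ key (layer t) (layer-keys↑ t) (layer-inRange t))

  Σcap≡bound : sumFin K (λ t → cap (toℕ t)) ≡ bound
  Σcap≡bound = sum-staircase K (m + n) (+-mono-≤ (<⇒≤ (<-≤-trans K<k k≤m)) (<⇒≤ (<-≤-trans K<k k≤n)))

  ones≤bound : ones A ≤ bound
  ones≤bound = begin
    ones A                                      ≡⟨ ones≡Σlayers ⟩
    sumFin K (λ t → length (layer (toℕ t)))     ≤⟨ sum-mono K (λ t → layer-length≤ (toℕ t) (FP.toℕ<n t)) ⟩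
    sumFin K (λ t → cap (toℕ t))                ≡⟨ Σcap≡bound ⟩
    bound                                       ∎
    where open ≤-Reasoning

  private
    sameRow-step : ∀ (i : Fin m) (j j' : Fin n) → key (i , j') ≡ suc (key (i , j)) → Step (i , j) (i , j')
    sameRow-step i j j' e = left (sym j'+1≡j)
      where
      n∸j' : n ∸ toℕ j' ≡ suc (n ∸ toℕ j)
      n∸j' = +-cancelʳ-≡ (toℕ i) _ _ e
      j'+1≡j : suc (toℕ j') ≡ toℕ j
      j'+1≡j = +-cancelʳ-≡ (n ∸ toℕ j) _ _ (begin
        suc (toℕ j') + (n ∸ toℕ j)    ≡⟨ sym (+-suc (toℕ j') _) ⟩
        toℕ j' + suc (n ∸ toℕ j)      ≡⟨ cong (toℕ j' +_) (sym n∸j') ⟩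
        toℕ j' + (n ∸ toℕ j')         ≡⟨ m+[n∸m]≡n (<⇒≤ (FP.toℕ<n j')) ⟩
        n                             ≡⟨ sym (m+[n∸m]≡n (<⇒≤ (FP.toℕ<n j))) ⟩
        toℕ j + (n ∸ toℕ j)           ∎)
        where open ≡-Reasoning

    +-split : ∀ {a b c d} → a + b ≡ c + d → c ≤ a → d ≤ b → a ≡ c × b ≡ d
    +-split {a} {b} {c} {d} e c≤a d≤b = a≡c , +-cancelˡ-≡ a b d (trans e (cong (_+ d) (sym a≡c)))
      where
      a≡c : a ≡ c
      a≡c = ≤-antisym (+-cancelʳ-≤ b a c (≤-trans (≤-reflexive e) (+-monoʳ-≤ c d≤b))) c≤a

    lowerRow-step : ∀ (i i' : Fin m) (j j' : Fin n) → toℕ i < toℕ i' → toℕ j' ≤ toℕ j →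
                    key (i' , j') ≡ suc (key (i , j)) → Step (i , j) (i' , j')
    lowerRow-step i i' j j' i<i' j'≤j e
      with +-split (trans e (sym (+-suc _ _))) (∸-monoʳ-≤ n j'≤j) i<i'
    ... | n∸j'≡n∸j , i'≡i+1
      with FP.toℕ-injective (∸-cancelˡ-≡ (<⇒≤ (FP.toℕ<n j')) (<⇒≤ (FP.toℕ<n j)) n∸j'≡n∸j)
    ...   | refl = below i'≡i+1

  key-step⇒Step : ∀ {x y} → LayerOrder x y → key y ≡ suc (key x) → Step x y
  key-step⇒Step {i , j} {i' , j'} (i≤i' , j'≤j , _) e with m≤n⇒m<n∨m≡n i≤i'
  ... | inj₁ i<i' = lowerRow-step i i' j j' i<i' j'≤j e
  ... | inj₂ i≡i' with FP.toℕ-injective i≡i'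
  ...   | refl = sameRow-step i j j' e

  -- Part (ii): when the bound is attained every layer is full, so its keys are
  -- consecutive and the layer is an R-L zigzag path.
  module Extremal (ones≡bound : ones A ≡ bound) where

    layer-full : ∀ (t : Fin K) → length (layer (toℕ t)) ≡ cap (toℕ t)
    layer-full = sum-≡⇒pointwise K (λ t → layer-length≤ (toℕ t) (FP.toℕ<n t))
                   (trans (sym ones≡Σlayers) (trans ones≡bound (sym Σcap≡bound)))

    layer-zigzag : ∀ (t : Fin K) → ZigzagPath (layer (toℕ t))
    layer-zigzag t =
      Lk.zipWith (λ (ordered , next) → key-step⇒Step ordered next)
                 (AllPairs⇒Linked (layer-sorted (toℕ t)) , consecutive)
      where
      consecutive : Linked (Keyed.NextKey key) (layer (toℕ t))
      consecutive = proj₁ (Keyed.tight⇒consecutive key (layer (toℕ t)) (layer-keys↑ (toℕ t))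
                             (layer-inRange (toℕ t))
                             (trans (layer-full t) (sym (range-size (toℕ t) (FP.toℕ<n t)))))

  -- Part (iii).  A zero with slack exists, or else every diagonal from the
  -- border meets every layer (DiagonalWalk), so every layer fills its interval
  -- of keys and A has at least `bound` ones.
  SlackZero : ℕ → ℕ → Set
  SlackZero i j = B i j ≡ false × suc (depth i j + height i j) < k

  slackZero? : ∀ i j → Dec (SlackZero i j)
  slackZero? i j with B i j 𝔹.≟ false | suc (depth i j + height i j) <? k
  ... | yes z  | yes s = yes (z , s)
  ... | no ¬z  | _     = no (¬z ∘ proj₁)
  ... | _      | no ¬s = no (¬s ∘ proj₂)

  module Saturated (saturated : ∀ i j → i < m → j < n → ¬ SlackZero i j) where

    module Diagonal (t : ℕ) (t<K : t < K) (i₀ j₀ : ℕ) (border : i₀ ≡ 0 ⊎ j₀ ≡ 0)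
                    (t<m∸i₀ : t < m ∸ i₀) (t<n∸j₀ : t < n ∸ j₀) where
      L : ℕ
      L = (m ∸ i₀) ⊓ (n ∸ j₀)

      t<L : t < L
      t<L = ⊓-glb t<m∸i₀ t<n∸j₀

      private
        a+s< : ∀ {a s M} → s < M ∸ a → a + s < M
        a+s< {a} {s} {M} s<M∸a with a ≤? M
        ... | yes a≤M = subst (a + s <_) (m+[n∸m]≡n a≤M) (+-monoʳ-< a s<M∸a)
        ... | no a≰M  = ⊥-elim (n≮0 (subst (s <_) (m≤n⇒m∸n≡0 (<⇒≤ (≰⇒> a≰M))) s<M∸a))

        -- one step past the last position of the diagonal leaves the matrix
        past-end : ∀ {a ℓ M} → 0 < ℓ → a + ℓ ≡ M → M ∸ suc (a + (ℓ ∸ 1)) ≡ 0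
        past-end {a} {suc ℓ} {M} _ e =
          subst (λ x → M ∸ x ≡ 0) (sym (trans (sym (+-suc a ℓ)) e)) (n∸n≡0 M)

        ∸-suc≤ : ∀ M x → M ∸ x ≤ suc (M ∸ suc x)
        ∸-suc≤ zero    x       = ≤-trans (≤-reflexive (0∸n≡0 x)) z≤n
        ∸-suc≤ (suc M) zero    = ≤-refl
        ∸-suc≤ (suc M) (suc x) = ∸-suc≤ M x

      row<m : ∀ {s} → s < L → i₀ + s < m
      row<m s<L = a+s< (<-≤-trans s<L (m⊓n≤m _ _))

      col<n : ∀ {s} → s < L → j₀ + s < n
      col<n s<L = a+s< (<-≤-trans s<L (m⊓n≤n _ _))

      α β : ℕ → ℕ
      α s = depth (i₀ + s) (j₀ + s)
      β s = height (i₀ + s) (j₀ + s)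

      OneAt : ℕ → Set
      OneAt s = One (i₀ + s , j₀ + s)

      α-start : α 0 ≡ 0
      α-start = onBorder i₀ j₀ border
        where
        onBorder : ∀ a b → a ≡ 0 ⊎ b ≡ 0 → depth (a + 0) (b + 0) ≡ 0
        onBorder a b (inj₁ refl) = refl
        onBorder a b (inj₂ refl) = depth-col0 (a + 0)

      α-mono : ∀ s s' → s ≤ s' → α s ≤ α s'
      α-mono s s' s≤s' = depth-mono (+-monoʳ-≤ i₀ s≤s') (+-monoʳ-≤ j₀ s≤s')

      α-step : ∀ s → α (suc s) ≤ suc (α s)
      α-step s = subst₂ (λ x y → depth x y ≤ suc (α s)) (sym (+-suc i₀ s)) (sym (+-suc j₀ s))
                   (depth-diagStep (i₀ + s) (j₀ + s))

      β-end : β (L ∸ 1) ≡ 0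
      β-end with ⊓-sel (m ∸ i₀) (n ∸ j₀)
      ... | inj₁ e = cong (λ x → Rot.depth x (n ∸ suc (j₀ + (L ∸ 1))))
                       (past-end (≤-<-trans z≤n t<L) (trans (cong (i₀ +_) e) (m+[n∸m]≡n i₀≤m)))
        where
        i₀≤m : i₀ ≤ m
        i₀≤m = ≤-trans (m≤m+n i₀ t) (<⇒≤ (a+s< t<m∸i₀))
      ... | inj₂ e = trans (cong (Rot.depth (m ∸ suc (i₀ + (L ∸ 1))))
                             (past-end (≤-<-trans z≤n t<L) (trans (cong (j₀ +_) e) (m+[n∸m]≡n j₀≤n))))
                           (Rot.depth-col0 (m ∸ suc (i₀ + (L ∸ 1))))
        where
        j₀≤n : j₀ ≤ n
        j₀≤n = ≤-trans (m≤m+n j₀ t) (<⇒≤ (a+s< t<n∸j₀))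

      β-anti : ∀ s s' → s ≤ s' → β s' ≤ β s
      β-anti s s' s≤s' = Rot.depth-mono (∸-monoʳ-≤ m (s≤s (+-monoʳ-≤ i₀ s≤s')))
                                        (∸-monoʳ-≤ n (s≤s (+-monoʳ-≤ j₀ s≤s')))

      β-step : ∀ s → β s ≤ suc (β (suc s))
      β-step s = subst₂ (λ x y → β s ≤ suc (Rot.depth (m ∸ suc x) (n ∸ suc y))) (sym (+-suc i₀ s)) (sym (+-suc j₀ s))
                   (≤-trans (Rot.depth-mono (∸-suc≤ m (suc (i₀ + s))) (∸-suc≤ n (suc (j₀ + s))))
                            (Rot.depth-diagStep (m ∸ suc (suc (i₀ + s))) (n ∸ suc (suc (j₀ + s)))))

      α-jump-slack : ∀ s → suc s < L → α (suc s) ≡ suc (α s) → suc (α s + β s) < k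
      α-jump-slack s s+1<L jump =
        depthJump-slack (i₀ + s) (j₀ + s) (subst (_< m) (+-suc i₀ s) (row<m s+1<L))
          (subst (_< n) (+-suc j₀ s) (col<n s+1<L)) (trans (sym (cong₂ depth (+-suc i₀ s) (+-suc j₀ s))) jump)

      β-drop-slack : ∀ s → suc s < L → β s ≡ suc (β (suc s)) → suc (α (suc s) + β (suc s)) < k
      β-drop-slack s s+1<L drop =
        subst₂ (λ x y → suc (depth x y + height x y) < k) (sym (+-suc i₀ s)) (sym (+-suc j₀ s))
          (heightDrop-slack (i₀ + s) (j₀ + s) (subst (_< m) (+-suc i₀ s) (row<m s+1<L))
            (subst (_< n) (+-suc j₀ s) (col<n s+1<L)) (trans drop (cong suc (cong₂ height (+-suc i₀ s) (+-suc j₀ s)))))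

      ones-α↑ : ∀ s s' → s < s' → OneAt s → α s < α s'
      ones-α↑ s s' s<s' = depth-one< (+-monoʳ-< i₀ s<s' , +-monoʳ-< j₀ s<s')

      slack⇒one : ∀ s → s < L → suc (α s + β s) < k → OneAt s
      slack⇒one s s<L slack with B (i₀ + s) (j₀ + s) in eq
      ... | true  = refl
      ... | false = ⊥-elim (saturated (i₀ + s) (j₀ + s) (row<m s<L) (col<n s<L) (eq , slack))

      open DiagonalWalk k L α β OneAt α-start α-mono α-step β-end β-anti β-step
                        α-jump-slack β-drop-slack ones-α↑ slack⇒one

      key-onDiagonal : ∀ s → j₀ + s ≤ n → (n ∸ (j₀ + s)) + (i₀ + s) ≡ (n ∸ j₀) + i₀
      key-onDiagonal s le = begin
          (n ∸ (j₀ + s)) + (i₀ + s)   ≡⟨ cong (_+ (i₀ + s)) (sym (∸-+-assoc n j₀ s)) ⟩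
          (n ∸ j₀ ∸ s) + (i₀ + s)     ≡⟨ cong ((n ∸ j₀ ∸ s) +_) (+-comm i₀ s) ⟩
          (n ∸ j₀ ∸ s) + (s + i₀)     ≡⟨ sym (+-assoc (n ∸ j₀ ∸ s) s i₀) ⟩
          (n ∸ j₀ ∸ s) + s + i₀       ≡⟨ cong (_+ i₀) (m∸n+n≡m s≤n∸j₀) ⟩
          (n ∸ j₀) + i₀ ∎
        where
        open ≡-Reasoning
        s≤n∸j₀ : s ≤ n ∸ j₀
        s≤n∸j₀ = subst (_≤ n ∸ j₀) (m+n∸m≡n j₀ s) (∸-monoˡ-≤ j₀ le)

      meets-layer : Σ (Fin m × Fin n) λ x → x ∈ layer t × key x ≡ (n ∸ j₀) + i₀
      meets-layer with level-attained t (≤-<-trans t<K K<k) t<L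
      ... | s , s<L , one , αs≡t = (i , j) , ∈-trueCells⁺ m n (inLayer t) (inLayer⁺ t i j A≡1 depth≡t) , key≡
        where
        i = fromℕ< (row<m s<L)
        j = fromℕ< (col<n s<L)
        toℕi : toℕ i ≡ i₀ + s
        toℕi = FP.toℕ-fromℕ< (row<m s<L)
        toℕj : toℕ j ≡ j₀ + s
        toℕj = FP.toℕ-fromℕ< (col<n s<L)
        A≡1 : A i j ≡ true
        A≡1 = trans (sym (B-agrees i j)) (trans (cong₂ B toℕi toℕj) one)
        depth≡t : depthAt i j ≡ t
        depth≡t = trans (cong₂ depth toℕi toℕj) αs≡t
        key≡ : key (i , j) ≡ (n ∸ j₀) + i₀
        key≡ = trans (cong₂ (λ a b → (n ∸ a) + b) toℕj toℕi) (key-onDiagonal s (<⇒≤ (col<n s<L)))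

    -- Every key of the interval of layer t is attained: use the diagonal
    -- starting at (0 , n - v) when v ≤ n, and at (v - n , 0) otherwise.
    layer-covers : ∀ t → t < K → ∀ v → lo t ≤ v → v ≤ hi t → Σ (Fin m × Fin n) λ x → x ∈ layer t × key x ≡ v
    layer-covers t t<K v lo≤v v≤hi with v ≤? n
    ... | yes v≤n =
      let (x , x∈ , e) = Diagonal.meets-layer t t<K 0 (n ∸ v) (inj₁ refl) (t<m t<K)
                           (subst (t <_) (sym (m∸[m∸n]≡n v≤n)) lo≤v)
      in x , x∈ , trans e (trans (+-identityʳ _) (m∸[m∸n]≡n v≤n))
    ... | no v≰n =
      let (x , x∈ , e) = Diagonal.meets-layer t t<K (v ∸ n) 0 (inj₂ refl) t<m∸[v∸n] (t<n t<K)
      in x , x∈ , trans e (m+[n∸m]≡n (<⇒≤ (≰⇒> v≰n)))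
      where
      t+[v∸n]<m : t + (v ∸ n) < m
      t+[v∸n]<m = +-cancelʳ-< n _ _ (begin-strict
        t + (v ∸ n) + n         ≡⟨ +-assoc t (v ∸ n) n ⟩
        t + (v ∸ n + n)         ≡⟨ cong (t +_) (m∸n+n≡m (<⇒≤ (≰⇒> v≰n))) ⟩
        t + v                   ≤⟨ +-monoʳ-≤ t v≤hi ⟩
        t + ((n ∸ t) + (m ∸ 1)) ≡⟨ sym (+-assoc t (n ∸ t) (m ∸ 1)) ⟩
        t + (n ∸ t) + (m ∸ 1)   ≡⟨ cong (_+ (m ∸ 1)) (m+[n∸m]≡n (<⇒≤ (t<n t<K))) ⟩
        n + (m ∸ 1)             ≡⟨ +-comm n (m ∸ 1) ⟩
        (m ∸ 1) + n             <⟨ +-monoˡ-< n (pred∸< (t<m t<K)) ⟩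
        m + n                   ∎)
        where open ≤-Reasoning
      t<m∸[v∸n] : t < m ∸ (v ∸ n)
      t<m∸[v∸n] = +-cancelʳ-< (v ∸ n) t (m ∸ (v ∸ n))
                    (subst (t + (v ∸ n) <_) (sym (m∸n+n≡m (≤-trans (m≤n+m _ t) (<⇒≤ t+[v∸n]<m)))) t+[v∸n]<m)

    layer-length≥ : ∀ t → t < K → cap t ≤ length (layer t)
    layer-length≥ t t<K = subst (_≤ length (layer t)) (range-size t t<K)
      (Keyed.covering⇒length-≥ key (lo t) (hi t) (layer t) (layer-keys↑ t) (layer-covers t t<K))

    bound≤ones : bound ≤ ones A
    bound≤ones = begin
      bound                                   ≡⟨ sym Σcap≡bound ⟩
      sumFin K (λ t → cap (toℕ t))            ≤⟨ sum-mono K (λ t → layer-length≥ (toℕ t) (FP.toℕ<n t)) ⟩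
      sumFin K (λ t → length (layer (toℕ t))) ≡⟨ sym ones≡Σlayers ⟩
      ones A                                  ∎
      where open ≤-Reasoning

  extendable : ones A < bound → Σ (Fin m) λ i → Σ (Fin n) λ j → A i j ≡ false × Avoiding k (setOne A i j)
  extendable ones<bound
    with search (λ i → Σ ℕ λ j → j < n × SlackZero i j) (λ i → search-dec (SlackZero i) (slackZero? i) n) m
  ... | inj₁ (i , i<m , j , j<n , isZero , slack) =
    fromℕ< i<m , fromℕ< j<n ,
    trans (sym (B-agrees (fromℕ< i<m) (fromℕ< j<n))) (trans (cong₂ B toℕi toℕj) isZero) ,
    AddOne.setOne-avoiding A k av (fromℕ< i<m) (fromℕ< j<n)
      (subst₂ (λ x y → suc (depth x y + height x y) < k) (sym toℕi) (sym toℕj) slack)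
    where
    toℕi : toℕ (fromℕ< i<m) ≡ i
    toℕi = FP.toℕ-fromℕ< i<m
    toℕj : toℕ (fromℕ< j<n) ≡ j
    toℕj = FP.toℕ-fromℕ< j<n
  ... | inj₂ none = ⊥-elim (<⇒≱ ones<bound (Saturated.bound≤ones (λ i j i<m j<n z → none i i<m (j , j<n , z))))

ones-setOne : ∀ {m n} (A : Matrix m n) i j → A i j ≡ false → ones (setOne A i j) ≡ suc (ones A)
ones-setOne {m} {n} A i j isZero =
  sum-increment m (λ i' → sumFin n (λ j' → bit (A i' j'))) (λ i' → sumFin n (λ j' → bit (setOne A i j i' j'))) i
    (λ i' i'≢i → sum-cong n (λ j' → cong bit (setOne-other A i j i' j' (i'≢i ∘ proj₁))))
    (sum-increment n (λ j' → bit (A i j')) (λ j' → bit (setOne A i j i j')) j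
      (λ j' j'≢j → cong bit (setOne-other A i j i j' (j'≢j ∘ proj₂)))
      (trans (cong bit (setOne-same A i j)) (cong (suc ∘ bit) (sym isZero))))

-- Existence in (i): starting from the zero matrix, keep adding ones by (iii).
bound-attained : ∀ {m n k} → 1 ≤ k → k ≤ m → k ≤ n →
  Σ (Matrix m n) λ A → Avoiding k A × ones A ≡ (k ∸ 1) * (m + n ∸ (k ∸ 1))
bound-attained {m} {n} {k} 1≤k k≤m k≤n =
  fill bound zeroMatrix zero-avoiding (cong (_+ bound) (sum-zero m (λ _ → sum-zero n (λ _ → refl))))
  where
  bound : ℕ
  bound = (k ∸ 1) * (m + n ∸ (k ∸ 1))
  zeroMatrix : Matrix m n
  zeroMatrix _ _ = false
  zero-avoiding : Avoiding k zeroMatrix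
  zero-avoiding (_ , _ , _ , _ , on) with on (fromℕ< 1≤k)
  ... | ()
  fill : ∀ d (A : Matrix m n) → Avoiding k A → ones A + d ≡ bound →
         Σ (Matrix m n) λ A → Avoiding k A × ones A ≡ bound
  fill zero    A av e = A , av , trans (sym (+-identityʳ _)) e
  fill (suc d) A av e with Layers.extendable 1≤k k≤m k≤n A av ones<bound
    where
    ones<bound : ones A < bound
    ones<bound = subst (ones A <_) e (≤-trans (s≤s (m≤m+n (ones A) d)) (≤-reflexive (sym (+-suc (ones A) d))))
  ... | i , j , isZero , av' =
    fill d (setOne A i j) av' (trans (cong (_+ d) (ones-setOne A i j isZero)) (trans (sym (+-suc _ d)) e))

-- The paths of (ii) are the layers.
theorem2p7 : (m n k : ℕ) → 3 ≤ k → k ≤ m → k ≤ n →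
    -- (i) the maximum number of 1's is (k-1)(m+n-(k-1))
    ((Σ (Matrix m n) λ A → Avoiding k A × ones A ≡ (k ∸ 1) * (m + n ∸ (k ∸ 1)))
     × ((A : Matrix m n) → Avoiding k A → ones A ≤ (k ∸ 1) * (m + n ∸ (k ∸ 1))))
    -- (ii) extremal matrices: 1's partition into k-1 R-L zigzag paths of lengths m+n-1, m+n-3, …
    × ((A : Matrix m n) → Avoiding k A → ones A ≡ (k ∸ 1) * (m + n ∸ (k ∸ 1)) →
        Σ (Fin (k ∸ 1) → List (Pos m n)) λ P →
          ((t : Fin (k ∸ 1)) → ZigzagPath (P t)
                              × length (P t) ≡ m + n ∸ (2 * toℕ t + 1))
          × ((t : Fin (k ∸ 1)) (i : Fin m) (j : Fin n) → (i , j) ∈ P t → A i j ≡ true)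
          × ((i : Fin m) (j : Fin n) → A i j ≡ true →
               Σ (Fin (k ∸ 1)) λ t → (i , j) ∈ P t
                 × ((t' : Fin (k ∸ 1)) → (i , j) ∈ P t' → t' ≡ t)))
    -- (iii) non-extremal avoiding matrices can be extended by one 1
    × ((A : Matrix m n) → Avoiding k A → ones A < (k ∸ 1) * (m + n ∸ (k ∸ 1)) →
        Σ (Fin m) λ i → Σ (Fin n) λ j → A i j ≡ false × Avoiding k (setOne A i j))
theorem2p7 m n k 3≤k k≤m k≤n =
  (bound-attained 1≤k k≤m k≤n , Layers.ones≤bound 1≤k k≤m k≤n) ,
  (λ A av ones≡bound → let open Layers 1≤k k≤m k≤n A av
                           open Extremal ones≡bound
                       in layer ∘ toℕ , (λ t → layer-zigzag t , layer-full t) , layer-ones ∘ toℕ , one-layer) ,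
  Layers.extendable 1≤k k≤m k≤n
  where
  1≤k : 1 ≤ k
  1≤k = ≤-trans (s≤s z≤n) 3≤k
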